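{- Every prime graph with $n\le 50$ vertices is odd prime.
   Context: All graphs are finite and simple. A prime labeling of a graph $G$ with $n$ vertices is a bijection $f:V(G)\to\{1,2,\dots,n\}$ such that $\gcd(f(u),f(v))=1$ for every edge $uv$; $G$ is prime if it has one. An odd prime labeling of $G$ is a bijection $\ell:V(G)\to\{1,3,\dots,2n-1\}$ such that $\gcd(\ell(u),\ell(v))=1$ for every edge $uv$; $G$ is odd prime if it has one. -}

module Defs where

open import Data.Nat using (ℕ; suc; _+_; _*_)
open import Data.Nat.GCD using (gcd)
open import Data.Fin using (Fin; toℕ)
open import Data.Product using (Σ; _×_)
open import Relation.Binary.PropositionalEquality using (_≡_)
open import Relation.Nullary using (¬_)
open import Function.Bundles using (_⤖_; Bijection)
open import Data.Bool using (Bool; true; false; T)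

record Graph (n : ℕ) : Set where
  field
    adj         : Fin n → Fin n → Bool
    symmetric   : ∀ u v → adj u v ≡ adj v u
    irreflexive : ∀ u → adj u u ≡ false

Adj : ∀ {n} → Graph n → Fin n → Fin n → Set
Adj G u v = T (Graph.adj G u v)

-- A bijection σ : V → Fin n encodes the labeling f(v) = toℕ (σ v) + 1,
-- i.e. a bijection onto {1, …, n}.
label : ∀ {n} → Fin n → ℕ
label i = suc (toℕ i)

oddLabel : ∀ {n} → Fin n → ℕ
oddLabel i = suc (2 * toℕ i)

IsPrimeLabeling : ∀ {n} → Graph n → (Fin n ⤖ Fin n) → Set
IsPrimeLabeling G σ =
  ∀ u v → Adj G u v → gcd (label (Bijection.to σ u)) (label (Bijection.to σ v)) ≡ 1

IsOddPrimeLabeling : ∀ {n} → Graph n → (Fin n ⤖ Fin n) → Set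
IsOddPrimeLabeling G σ =
  ∀ u v → Adj G u v → gcd (oddLabel (Bijection.to σ u)) (oddLabel (Bijection.to σ v)) ≡ 1

IsPrimeGraph : ∀ {n} → Graph n → Set
IsPrimeGraph G = Σ (_ ⤖ _) (IsPrimeLabeling G)

IsOddPrimeGraph : ∀ {n} → Graph n → Set
IsOddPrimeGraph G = Σ (_ ⤖ _) (IsOddPrimeLabeling G)

{-# OPTIONS --safe #-}
-- Composing a prime labeling with a permutation τ of {1, …, n} into the odd labels
-- {1, 3, …, 2n − 1} that sends coprime labels to coprime odd labels gives an odd
-- prime labeling of the same graph, whatever the graph. So it suffices to exhibit one
-- such τ for each n ≤ 50; those below were found by computer search, and their
-- bijectivity and preservation of coprimality are checked by evaluation.
module Submission where

open import Defs
open import Data.Nat using (ℕ; _≤_; s≤s; _≟_)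
open import Data.Nat.GCD using (gcd)
open import Data.Fin using (Fin; #_)
open import Data.Fin.Properties using (all?; any?) renaming (_≟_ to _≟ᶠ_)
open import Data.List using (upTo)
open import Data.List.Membership.Propositional.Properties using (∈-upTo⁺)
open import Data.List.Relation.Unary.All using (All; []; _∷_) renaming (lookup to lookupAll)
open import Data.Vec using (Vec; []; _∷_; lookup)
open import Data.Product using (_,_)
open import Function.Bundles using (_⤖_; Bijection; mk⤖)
open import Function.Construct.Composition using (_⤖-∘_)
open import Function.Definitions using (Injective; Surjective; Bijective)
open import Function.Consequences.Propositional using (strictlySurjective⇒surjective)
open import Relation.Binary.PropositionalEquality using (_≡_; refl)
open import Relation.Nullary using (Dec; map′)
open import Relation.Nullary.Decidable using (True; toWitness; _×-dec_; _→-dec_)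

PreservesCoprimality : ∀ {n} → (Fin n → Fin n) → Set
PreservesCoprimality f =
  ∀ i j → gcd (label i) (label j) ≡ 1 → gcd (oddLabel (f i)) (oddLabel (f j)) ≡ 1

record OddRelabelling (n : ℕ) : Set where
  field
    relabel              : Fin n ⤖ Fin n
    preservesCoprimality : PreservesCoprimality (Bijection.to relabel)

prime⇒oddPrime : ∀ {n} → OddRelabelling n → (G : Graph n) → IsPrimeGraph G → IsOddPrimeGraph G
prime⇒oddPrime τ G (σ , coprime) =
  relabel ⤖-∘ σ , λ u v uv → preservesCoprimality _ _ (coprime u v uv)
  where open OddRelabelling τ

injective? : ∀ {m n} (f : Fin m → Fin n) → Dec (Injective _≡_ _≡_ f)
injective? f =
  map′ (λ inj {x} {y} → inj x y) (λ inj x y → inj)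
       (all? λ x → all? λ y → (f x ≟ᶠ f y) →-dec (x ≟ᶠ y))

surjective? : ∀ {m n} (f : Fin m → Fin n) → Dec (Surjective _≡_ _≡_ f)
surjective? f =
  map′ strictlySurjective⇒surjective (λ surj y → let x , fx≡y = surj y in x , fx≡y refl)
       (all? λ y → any? λ x → f x ≟ᶠ y)

bijective? : ∀ {m n} (f : Fin m → Fin n) → Dec (Bijective _≡_ _≡_ f)
bijective? f = injective? f ×-dec surjective? f

preservesCoprimality? : ∀ {n} (f : Fin n → Fin n) → Dec (PreservesCoprimality f)
preservesCoprimality? f =
  all? λ i → all? λ j →
    (gcd (label i) (label j) ≟ 1) →-dec (gcd (oddLabel (f i)) (oddLabel (f j)) ≟ 1)

fromImages : ∀ {n} (τ : Vec (Fin n) n) →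
             {True (bijective? (lookup τ) ×-dec preservesCoprimality? (lookup τ))} →
             OddRelabelling n
fromImages τ {checked} with toWitness checked
... | bijective , preserves = record
  { relabel              = mk⤖ bijective
  ; preservesCoprimality = preserves
  }

-- Entry n lists τ(0), …, τ(n − 1): the label i + 1 is sent to the odd label 2 τ(i) + 1.
relabellings : All OddRelabelling (upTo 51)
relabellings =
    fromImages [] ∷
    fromImages (# 0 ∷ []) ∷
    fromImages (# 0 ∷ # 1 ∷ []) ∷
    fromImages (# 0 ∷ # 1 ∷ # 2 ∷ []) ∷
    fromImages (# 0 ∷ # 2 ∷ # 1 ∷ # 3 ∷ []) ∷
    fromImages (# 0 ∷ # 4 ∷ # 2 ∷ # 1 ∷ # 3 ∷ []) ∷
    fromImages (# 0 ∷ # 1 ∷ # 3 ∷ # 4 ∷ # 2 ∷ # 5 ∷ []) ∷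
    fromImages (# 0 ∷ # 2 ∷ # 5 ∷ # 4 ∷ # 3 ∷ # 1 ∷ # 6 ∷ []) ∷
    fromImages (# 0 ∷ # 1 ∷ # 2 ∷ # 4 ∷ # 5 ∷ # 7 ∷ # 3 ∷ # 6 ∷ []) ∷
    fromImages (# 0 ∷ # 3 ∷ # 2 ∷ # 4 ∷ # 6 ∷ # 7 ∷ # 5 ∷ # 1 ∷ # 8 ∷ []) ∷
    fromImages (# 0 ∷ # 1 ∷ # 3 ∷ # 6 ∷ # 8 ∷ # 7 ∷ # 5 ∷ # 4 ∷ # 2 ∷ # 9 ∷ []) ∷
    fromImages (# 0 ∷ # 6 ∷ # 5 ∷ # 1 ∷ # 3 ∷ # 7 ∷ # 8 ∷ # 4 ∷ # 2 ∷ # 10 ∷ # 9 ∷ []) ∷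
    fromImages (# 0 ∷ # 8 ∷ # 2 ∷ # 4 ∷ # 3 ∷ # 7 ∷ # 9 ∷ # 1 ∷ # 6 ∷ # 10 ∷ # 5 ∷ # 11 ∷ []) ∷
    fromImages (# 0 ∷ # 8 ∷ # 12 ∷ # 5 ∷ # 3 ∷ # 7 ∷ # 9 ∷ # 4 ∷ # 2 ∷ # 10 ∷ # 6 ∷ # 1 ∷ # 11 ∷ []) ∷
    fromImages (# 0 ∷ # 1 ∷ # 6 ∷ # 13 ∷ # 3 ∷ # 7 ∷ # 9 ∷ # 4 ∷ # 12 ∷ # 10 ∷ # 8 ∷ # 2 ∷ # 5 ∷ # 11 ∷ []) ∷
    fromImages (# 0 ∷ # 4 ∷ # 2 ∷ # 13 ∷ # 3 ∷ # 8 ∷ # 11 ∷ # 5 ∷ # 12 ∷ # 10 ∷ # 9 ∷ # 7 ∷ # 6 ∷ # 1 ∷ # 14 ∷ []) ∷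
    fromImages (# 0 ∷ # 6 ∷ # 5 ∷ # 1 ∷ # 3 ∷ # 7 ∷ # 14 ∷ # 13 ∷ # 12 ∷ # 10 ∷ # 11 ∷ # 9 ∷ # 8 ∷ # 4 ∷ # 2 ∷ # 15 ∷ []) ∷
    fromImages (# 0 ∷ # 13 ∷ # 12 ∷ # 14 ∷ # 6 ∷ # 2 ∷ # 5 ∷ # 4 ∷ # 8 ∷ # 10 ∷ # 11 ∷ # 7 ∷ # 9 ∷ # 16 ∷ # 3 ∷ # 1 ∷ # 15 ∷ []) ∷
    fromImages (# 0 ∷ # 13 ∷ # 12 ∷ # 14 ∷ # 3 ∷ # 2 ∷ # 5 ∷ # 4 ∷ # 8 ∷ # 10 ∷ # 11 ∷ # 7 ∷ # 9 ∷ # 16 ∷ # 17 ∷ # 1 ∷ # 6 ∷ # 15 ∷ []) ∷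
    fromImages (# 0 ∷ # 14 ∷ # 12 ∷ # 15 ∷ # 3 ∷ # 2 ∷ # 5 ∷ # 13 ∷ # 8 ∷ # 10 ∷ # 11 ∷ # 7 ∷ # 9 ∷ # 16 ∷ # 17 ∷ # 4 ∷ # 6 ∷ # 1 ∷ # 18 ∷ []) ∷
    fromImages (# 0 ∷ # 13 ∷ # 12 ∷ # 1 ∷ # 6 ∷ # 16 ∷ # 15 ∷ # 10 ∷ # 2 ∷ # 19 ∷ # 14 ∷ # 17 ∷ # 11 ∷ # 4 ∷ # 5 ∷ # 3 ∷ # 9 ∷ # 7 ∷ # 8 ∷ # 18 ∷ []) ∷
    fromImages (# 0 ∷ # 10 ∷ # 12 ∷ # 13 ∷ # 18 ∷ # 3 ∷ # 6 ∷ # 4 ∷ # 11 ∷ # 16 ∷ # 15 ∷ # 17 ∷ # 14 ∷ # 19 ∷ # 2 ∷ # 5 ∷ # 9 ∷ # 7 ∷ # 8 ∷ # 1 ∷ # 20 ∷ []) ∷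
    fromImages (# 0 ∷ # 18 ∷ # 14 ∷ # 20 ∷ # 3 ∷ # 7 ∷ # 5 ∷ # 13 ∷ # 9 ∷ # 10 ∷ # 6 ∷ # 12 ∷ # 15 ∷ # 16 ∷ # 17 ∷ # 4 ∷ # 11 ∷ # 2 ∷ # 8 ∷ # 1 ∷ # 21 ∷ # 19 ∷ []) ∷
    fromImages (# 0 ∷ # 18 ∷ # 12 ∷ # 20 ∷ # 3 ∷ # 22 ∷ # 5 ∷ # 13 ∷ # 8 ∷ # 1 ∷ # 6 ∷ # 7 ∷ # 15 ∷ # 16 ∷ # 17 ∷ # 11 ∷ # 14 ∷ # 4 ∷ # 9 ∷ # 10 ∷ # 2 ∷ # 19 ∷ # 21 ∷ []) ∷
    fromImages (# 0 ∷ # 20 ∷ # 12 ∷ # 21 ∷ # 3 ∷ # 22 ∷ # 9 ∷ # 14 ∷ # 2 ∷ # 1 ∷ # 6 ∷ # 4 ∷ # 18 ∷ # 16 ∷ # 17 ∷ # 13 ∷ # 15 ∷ # 7 ∷ # 11 ∷ # 10 ∷ # 5 ∷ # 19 ∷ # 8 ∷ # 23 ∷ []) ∷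
    fromImages (# 0 ∷ # 20 ∷ # 12 ∷ # 21 ∷ # 24 ∷ # 22 ∷ # 9 ∷ # 14 ∷ # 2 ∷ # 3 ∷ # 6 ∷ # 4 ∷ # 18 ∷ # 16 ∷ # 17 ∷ # 13 ∷ # 15 ∷ # 7 ∷ # 11 ∷ # 10 ∷ # 5 ∷ # 19 ∷ # 8 ∷ # 1 ∷ # 23 ∷ []) ∷
    fromImages (# 0 ∷ # 20 ∷ # 12 ∷ # 21 ∷ # 24 ∷ # 2 ∷ # 9 ∷ # 13 ∷ # 18 ∷ # 10 ∷ # 6 ∷ # 7 ∷ # 8 ∷ # 16 ∷ # 17 ∷ # 4 ∷ # 15 ∷ # 22 ∷ # 14 ∷ # 3 ∷ # 5 ∷ # 19 ∷ # 11 ∷ # 1 ∷ # 23 ∷ # 25 ∷ []) ∷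
    fromImages (# 0 ∷ # 21 ∷ # 12 ∷ # 23 ∷ # 24 ∷ # 7 ∷ # 15 ∷ # 13 ∷ # 20 ∷ # 10 ∷ # 6 ∷ # 22 ∷ # 8 ∷ # 16 ∷ # 17 ∷ # 11 ∷ # 18 ∷ # 4 ∷ # 14 ∷ # 1 ∷ # 5 ∷ # 19 ∷ # 9 ∷ # 2 ∷ # 3 ∷ # 25 ∷ # 26 ∷ []) ∷
    fromImages (# 0 ∷ # 21 ∷ # 14 ∷ # 23 ∷ # 24 ∷ # 12 ∷ # 5 ∷ # 13 ∷ # 20 ∷ # 10 ∷ # 6 ∷ # 22 ∷ # 8 ∷ # 16 ∷ # 17 ∷ # 4 ∷ # 18 ∷ # 1 ∷ # 15 ∷ # 3 ∷ # 27 ∷ # 19 ∷ # 11 ∷ # 7 ∷ # 9 ∷ # 25 ∷ # 2 ∷ # 26 ∷ []) ∷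
    fromImages (# 0 ∷ # 2 ∷ # 15 ∷ # 13 ∷ # 24 ∷ # 28 ∷ # 8 ∷ # 12 ∷ # 18 ∷ # 17 ∷ # 23 ∷ # 4 ∷ # 6 ∷ # 25 ∷ # 3 ∷ # 22 ∷ # 21 ∷ # 27 ∷ # 20 ∷ # 10 ∷ # 9 ∷ # 7 ∷ # 14 ∷ # 16 ∷ # 11 ∷ # 19 ∷ # 5 ∷ # 1 ∷ # 26 ∷ []) ∷
    fromImages (# 0 ∷ # 5 ∷ # 12 ∷ # 24 ∷ # 26 ∷ # 22 ∷ # 20 ∷ # 4 ∷ # 23 ∷ # 13 ∷ # 6 ∷ # 7 ∷ # 8 ∷ # 28 ∷ # 15 ∷ # 16 ∷ # 21 ∷ # 27 ∷ # 18 ∷ # 10 ∷ # 9 ∷ # 19 ∷ # 14 ∷ # 17 ∷ # 11 ∷ # 25 ∷ # 2 ∷ # 3 ∷ # 29 ∷ # 1 ∷ []) ∷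
    fromImages (# 0 ∷ # 23 ∷ # 27 ∷ # 29 ∷ # 24 ∷ # 7 ∷ # 9 ∷ # 18 ∷ # 12 ∷ # 3 ∷ # 8 ∷ # 19 ∷ # 26 ∷ # 28 ∷ # 17 ∷ # 13 ∷ # 21 ∷ # 22 ∷ # 20 ∷ # 10 ∷ # 6 ∷ # 25 ∷ # 15 ∷ # 16 ∷ # 14 ∷ # 1 ∷ # 5 ∷ # 4 ∷ # 11 ∷ # 2 ∷ # 30 ∷ []) ∷
    fromImages (# 0 ∷ # 25 ∷ # 24 ∷ # 13 ∷ # 12 ∷ # 3 ∷ # 15 ∷ # 23 ∷ # 20 ∷ # 22 ∷ # 9 ∷ # 10 ∷ # 29 ∷ # 19 ∷ # 27 ∷ # 1 ∷ # 26 ∷ # 31 ∷ # 21 ∷ # 7 ∷ # 6 ∷ # 28 ∷ # 18 ∷ # 16 ∷ # 2 ∷ # 8 ∷ # 5 ∷ # 4 ∷ # 14 ∷ # 17 ∷ # 11 ∷ # 30 ∷ []) ∷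
    fromImages (# 0 ∷ # 24 ∷ # 26 ∷ # 28 ∷ # 29 ∷ # 17 ∷ # 5 ∷ # 10 ∷ # 12 ∷ # 31 ∷ # 6 ∷ # 1 ∷ # 8 ∷ # 16 ∷ # 20 ∷ # 9 ∷ # 23 ∷ # 22 ∷ # 21 ∷ # 13 ∷ # 27 ∷ # 19 ∷ # 18 ∷ # 7 ∷ # 15 ∷ # 25 ∷ # 2 ∷ # 4 ∷ # 14 ∷ # 3 ∷ # 11 ∷ # 30 ∷ # 32 ∷ []) ∷
    fromImages (# 0 ∷ # 23 ∷ # 26 ∷ # 30 ∷ # 24 ∷ # 22 ∷ # 5 ∷ # 29 ∷ # 20 ∷ # 31 ∷ # 6 ∷ # 2 ∷ # 8 ∷ # 16 ∷ # 17 ∷ # 15 ∷ # 9 ∷ # 7 ∷ # 21 ∷ # 1 ∷ # 27 ∷ # 19 ∷ # 18 ∷ # 13 ∷ # 3 ∷ # 25 ∷ # 12 ∷ # 4 ∷ # 14 ∷ # 10 ∷ # 11 ∷ # 33 ∷ # 32 ∷ # 28 ∷ []) ∷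
    fromImages (# 0 ∷ # 13 ∷ # 24 ∷ # 23 ∷ # 30 ∷ # 32 ∷ # 5 ∷ # 29 ∷ # 3 ∷ # 14 ∷ # 11 ∷ # 22 ∷ # 8 ∷ # 16 ∷ # 17 ∷ # 19 ∷ # 9 ∷ # 31 ∷ # 26 ∷ # 6 ∷ # 27 ∷ # 34 ∷ # 21 ∷ # 10 ∷ # 20 ∷ # 25 ∷ # 12 ∷ # 4 ∷ # 18 ∷ # 7 ∷ # 15 ∷ # 1 ∷ # 2 ∷ # 28 ∷ # 33 ∷ []) ∷
    fromImages (# 0 ∷ # 23 ∷ # 32 ∷ # 33 ∷ # 24 ∷ # 28 ∷ # 5 ∷ # 18 ∷ # 9 ∷ # 31 ∷ # 8 ∷ # 7 ∷ # 30 ∷ # 16 ∷ # 17 ∷ # 29 ∷ # 26 ∷ # 19 ∷ # 21 ∷ # 34 ∷ # 27 ∷ # 25 ∷ # 20 ∷ # 22 ∷ # 11 ∷ # 13 ∷ # 12 ∷ # 4 ∷ # 15 ∷ # 10 ∷ # 14 ∷ # 1 ∷ # 6 ∷ # 35 ∷ # 3 ∷ # 2 ∷ []) ∷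
    fromImages (# 0 ∷ # 23 ∷ # 9 ∷ # 15 ∷ # 24 ∷ # 28 ∷ # 14 ∷ # 25 ∷ # 29 ∷ # 3 ∷ # 6 ∷ # 2 ∷ # 11 ∷ # 16 ∷ # 17 ∷ # 33 ∷ # 35 ∷ # 22 ∷ # 30 ∷ # 31 ∷ # 27 ∷ # 19 ∷ # 26 ∷ # 7 ∷ # 18 ∷ # 34 ∷ # 12 ∷ # 4 ∷ # 21 ∷ # 10 ∷ # 20 ∷ # 13 ∷ # 32 ∷ # 8 ∷ # 5 ∷ # 1 ∷ # 36 ∷ []) ∷
    fromImages (# 0 ∷ # 29 ∷ # 21 ∷ # 35 ∷ # 24 ∷ # 2 ∷ # 23 ∷ # 33 ∷ # 30 ∷ # 31 ∷ # 6 ∷ # 37 ∷ # 8 ∷ # 16 ∷ # 17 ∷ # 13 ∷ # 9 ∷ # 22 ∷ # 11 ∷ # 10 ∷ # 27 ∷ # 19 ∷ # 26 ∷ # 12 ∷ # 14 ∷ # 25 ∷ # 18 ∷ # 5 ∷ # 20 ∷ # 7 ∷ # 15 ∷ # 4 ∷ # 32 ∷ # 28 ∷ # 3 ∷ # 1 ∷ # 36 ∷ # 34 ∷ []) ∷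
    fromImages (# 0 ∷ # 29 ∷ # 21 ∷ # 35 ∷ # 24 ∷ # 2 ∷ # 23 ∷ # 33 ∷ # 30 ∷ # 31 ∷ # 6 ∷ # 37 ∷ # 8 ∷ # 16 ∷ # 17 ∷ # 13 ∷ # 9 ∷ # 22 ∷ # 11 ∷ # 10 ∷ # 27 ∷ # 19 ∷ # 26 ∷ # 12 ∷ # 3 ∷ # 25 ∷ # 18 ∷ # 5 ∷ # 20 ∷ # 7 ∷ # 15 ∷ # 4 ∷ # 32 ∷ # 28 ∷ # 38 ∷ # 1 ∷ # 14 ∷ # 34 ∷ # 36 ∷ []) ∷
    fromImages (# 0 ∷ # 30 ∷ # 21 ∷ # 36 ∷ # 24 ∷ # 1 ∷ # 23 ∷ # 35 ∷ # 33 ∷ # 31 ∷ # 6 ∷ # 12 ∷ # 8 ∷ # 16 ∷ # 17 ∷ # 29 ∷ # 9 ∷ # 22 ∷ # 11 ∷ # 10 ∷ # 27 ∷ # 19 ∷ # 26 ∷ # 37 ∷ # 3 ∷ # 25 ∷ # 18 ∷ # 5 ∷ # 20 ∷ # 7 ∷ # 15 ∷ # 13 ∷ # 32 ∷ # 28 ∷ # 38 ∷ # 4 ∷ # 14 ∷ # 34 ∷ # 2 ∷ # 39 ∷ []) ∷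
    fromImages (# 0 ∷ # 33 ∷ # 23 ∷ # 40 ∷ # 24 ∷ # 12 ∷ # 26 ∷ # 36 ∷ # 35 ∷ # 10 ∷ # 6 ∷ # 13 ∷ # 14 ∷ # 16 ∷ # 17 ∷ # 30 ∷ # 9 ∷ # 22 ∷ # 11 ∷ # 31 ∷ # 27 ∷ # 19 ∷ # 29 ∷ # 37 ∷ # 3 ∷ # 25 ∷ # 20 ∷ # 5 ∷ # 21 ∷ # 2 ∷ # 18 ∷ # 4 ∷ # 32 ∷ # 28 ∷ # 38 ∷ # 7 ∷ # 15 ∷ # 34 ∷ # 8 ∷ # 1 ∷ # 39 ∷ []) ∷
    fromImages (# 0 ∷ # 35 ∷ # 26 ∷ # 40 ∷ # 24 ∷ # 12 ∷ # 29 ∷ # 39 ∷ # 36 ∷ # 31 ∷ # 6 ∷ # 13 ∷ # 8 ∷ # 16 ∷ # 17 ∷ # 33 ∷ # 9 ∷ # 22 ∷ # 11 ∷ # 10 ∷ # 27 ∷ # 19 ∷ # 30 ∷ # 37 ∷ # 15 ∷ # 25 ∷ # 21 ∷ # 5 ∷ # 23 ∷ # 1 ∷ # 20 ∷ # 4 ∷ # 32 ∷ # 28 ∷ # 38 ∷ # 7 ∷ # 18 ∷ # 34 ∷ # 2 ∷ # 3 ∷ # 14 ∷ # 41 ∷ []) ∷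
    fromImages (# 0 ∷ # 35 ∷ # 26 ∷ # 40 ∷ # 24 ∷ # 12 ∷ # 29 ∷ # 39 ∷ # 36 ∷ # 31 ∷ # 6 ∷ # 13 ∷ # 8 ∷ # 16 ∷ # 17 ∷ # 33 ∷ # 9 ∷ # 22 ∷ # 11 ∷ # 10 ∷ # 27 ∷ # 19 ∷ # 30 ∷ # 37 ∷ # 15 ∷ # 25 ∷ # 21 ∷ # 5 ∷ # 23 ∷ # 2 ∷ # 20 ∷ # 4 ∷ # 32 ∷ # 28 ∷ # 38 ∷ # 7 ∷ # 18 ∷ # 34 ∷ # 42 ∷ # 3 ∷ # 14 ∷ # 1 ∷ # 41 ∷ []) ∷
    fromImages (# 0 ∷ # 40 ∷ # 30 ∷ # 36 ∷ # 24 ∷ # 37 ∷ # 5 ∷ # 43 ∷ # 39 ∷ # 4 ∷ # 6 ∷ # 2 ∷ # 8 ∷ # 16 ∷ # 17 ∷ # 33 ∷ # 9 ∷ # 22 ∷ # 11 ∷ # 10 ∷ # 27 ∷ # 19 ∷ # 35 ∷ # 12 ∷ # 21 ∷ # 25 ∷ # 26 ∷ # 13 ∷ # 29 ∷ # 31 ∷ # 23 ∷ # 14 ∷ # 32 ∷ # 28 ∷ # 38 ∷ # 7 ∷ # 20 ∷ # 34 ∷ # 42 ∷ # 3 ∷ # 18 ∷ # 1 ∷ # 15 ∷ # 41 ∷ []) ∷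
    fromImages (# 0 ∷ # 40 ∷ # 33 ∷ # 39 ∷ # 24 ∷ # 37 ∷ # 5 ∷ # 43 ∷ # 41 ∷ # 14 ∷ # 6 ∷ # 2 ∷ # 8 ∷ # 16 ∷ # 17 ∷ # 35 ∷ # 9 ∷ # 22 ∷ # 11 ∷ # 31 ∷ # 27 ∷ # 19 ∷ # 36 ∷ # 12 ∷ # 18 ∷ # 25 ∷ # 29 ∷ # 13 ∷ # 30 ∷ # 10 ∷ # 26 ∷ # 23 ∷ # 32 ∷ # 28 ∷ # 38 ∷ # 7 ∷ # 21 ∷ # 34 ∷ # 42 ∷ # 3 ∷ # 20 ∷ # 4 ∷ # 15 ∷ # 1 ∷ # 44 ∷ []) ∷
    fromImages (# 0 ∷ # 40 ∷ # 36 ∷ # 3 ∷ # 33 ∷ # 42 ∷ # 14 ∷ # 25 ∷ # 30 ∷ # 19 ∷ # 41 ∷ # 7 ∷ # 39 ∷ # 38 ∷ # 32 ∷ # 31 ∷ # 35 ∷ # 37 ∷ # 11 ∷ # 45 ∷ # 27 ∷ # 24 ∷ # 9 ∷ # 22 ∷ # 6 ∷ # 10 ∷ # 23 ∷ # 43 ∷ # 29 ∷ # 2 ∷ # 26 ∷ # 8 ∷ # 15 ∷ # 13 ∷ # 5 ∷ # 17 ∷ # 21 ∷ # 34 ∷ # 12 ∷ # 4 ∷ # 20 ∷ # 16 ∷ # 18 ∷ # 1 ∷ # 44 ∷ # 28 ∷ []) ∷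
    fromImages (# 0 ∷ # 40 ∷ # 39 ∷ # 36 ∷ # 18 ∷ # 32 ∷ # 15 ∷ # 35 ∷ # 29 ∷ # 3 ∷ # 41 ∷ # 37 ∷ # 8 ∷ # 16 ∷ # 17 ∷ # 13 ∷ # 9 ∷ # 1 ∷ # 11 ∷ # 45 ∷ # 27 ∷ # 6 ∷ # 14 ∷ # 22 ∷ # 24 ∷ # 25 ∷ # 26 ∷ # 46 ∷ # 33 ∷ # 31 ∷ # 30 ∷ # 19 ∷ # 12 ∷ # 28 ∷ # 38 ∷ # 7 ∷ # 23 ∷ # 34 ∷ # 42 ∷ # 10 ∷ # 21 ∷ # 5 ∷ # 20 ∷ # 4 ∷ # 2 ∷ # 43 ∷ # 44 ∷ []) ∷
    fromImages (# 0 ∷ # 11 ∷ # 33 ∷ # 40 ∷ # 26 ∷ # 22 ∷ # 41 ∷ # 43 ∷ # 2 ∷ # 1 ∷ # 39 ∷ # 16 ∷ # 8 ∷ # 9 ∷ # 38 ∷ # 34 ∷ # 36 ∷ # 47 ∷ # 15 ∷ # 45 ∷ # 27 ∷ # 28 ∷ # 35 ∷ # 37 ∷ # 24 ∷ # 25 ∷ # 12 ∷ # 13 ∷ # 30 ∷ # 10 ∷ # 29 ∷ # 19 ∷ # 5 ∷ # 14 ∷ # 3 ∷ # 32 ∷ # 23 ∷ # 46 ∷ # 42 ∷ # 31 ∷ # 21 ∷ # 7 ∷ # 20 ∷ # 6 ∷ # 17 ∷ # 4 ∷ # 18 ∷ # 44 ∷ []) ∷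
    fromImages (# 0 ∷ # 28 ∷ # 6 ∷ # 40 ∷ # 15 ∷ # 7 ∷ # 29 ∷ # 39 ∷ # 12 ∷ # 31 ∷ # 44 ∷ # 47 ∷ # 8 ∷ # 16 ∷ # 45 ∷ # 1 ∷ # 41 ∷ # 37 ∷ # 11 ∷ # 46 ∷ # 27 ∷ # 35 ∷ # 36 ∷ # 43 ∷ # 24 ∷ # 25 ∷ # 32 ∷ # 5 ∷ # 33 ∷ # 3 ∷ # 30 ∷ # 13 ∷ # 14 ∷ # 26 ∷ # 38 ∷ # 19 ∷ # 23 ∷ # 34 ∷ # 42 ∷ # 10 ∷ # 21 ∷ # 22 ∷ # 20 ∷ # 9 ∷ # 17 ∷ # 4 ∷ # 18 ∷ # 2 ∷ # 48 ∷ []) ∷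
    fromImages (# 0 ∷ # 43 ∷ # 41 ∷ # 14 ∷ # 6 ∷ # 37 ∷ # 24 ∷ # 40 ∷ # 29 ∷ # 19 ∷ # 44 ∷ # 7 ∷ # 8 ∷ # 38 ∷ # 32 ∷ # 46 ∷ # 39 ∷ # 47 ∷ # 36 ∷ # 16 ∷ # 17 ∷ # 49 ∷ # 11 ∷ # 22 ∷ # 35 ∷ # 25 ∷ # 12 ∷ # 31 ∷ # 33 ∷ # 4 ∷ # 30 ∷ # 15 ∷ # 26 ∷ # 28 ∷ # 45 ∷ # 27 ∷ # 23 ∷ # 13 ∷ # 42 ∷ # 9 ∷ # 21 ∷ # 10 ∷ # 20 ∷ # 5 ∷ # 2 ∷ # 34 ∷ # 18 ∷ # 1 ∷ # 3 ∷ # 48 ∷ []) ∷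
    []

mainTheorem19 : (n : ℕ) → n ≤ 50 → (G : Graph n) → IsPrimeGraph G → IsOddPrimeGraph G
mainTheorem19 n n≤50 = prime⇒oddPrime (lookupAll relabellings (∈-upTo⁺ (s≤s n≤50)))
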